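{- Let $\beta,\varepsilon>0$ and let $n,\Delta$ be positive integers such that $\Delta\beta+2\varepsilon<1$. Then for any tree $T$ on $n$ vertices with maximum degree at most $\Delta$, there exist subtrees $T_1\subseteq T'\subseteq T$ such that (a) $\beta n\le |T_1|\le\Delta\beta n$, (b) $e(T_1,T\setminus T_1)=1$, and (c) $|T\setminus T'|=2\varepsilon n$.
   Context: For graphs $F\subseteq T$, $|F|$ denotes the number of vertices of $F$, and $T\setminus F$ denotes the induced subgraph of $T$ on $V(T)\setminus V(F)$. $e(T_1,T\setminus T_1)$ is the number of edges of $T$ with one endpoint in $V(T_1)$ and the other in $V(T)\setminus V(T_1)$. Floors and ceilings are omitted (quantities such as $2\varepsilon n$ are treated as integers). -}

module Defs where

open import Data.Bool using (Bool; true; false; _∧_; not; if_then_else_)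
open import Data.Nat using (ℕ; zero; suc; _+_; _*_; _<ᵇ_)
open import Data.Fin using (Fin; toℕ)
open import Data.Fin.Subset using (Subset; _∈_; Nonempty)
import Data.Fin.Subset
import Data.Vec
open import Data.List using (List; map; allFin)
open import Data.Nat.ListAction using (sum)
open import Data.Product using (_×_)
open import Relation.Binary.PropositionalEquality using (_≡_)
open import Data.Integer using (+_)
open import Data.Rational using (ℚ; _/_)

ℕtoℚ : ℕ → ℚ
ℕtoℚ n = (+ n) / 1

record Graph (n : ℕ) : Set where
  field
    adj   : Fin n → Fin n → Bool
    sym   : ∀ u v → adj u v ≡ adj v u
    irrefl : ∀ v → adj v v ≡ false
open Graph public

bit : Bool → ℕ
bit true = 1
bit false = 0

Σv : ∀ {n} → (Fin n → ℕ) → ℕ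
Σv {n} f = sum (map f (allFin n))

degree : ∀ {n} → Graph n → Fin n → ℕ
degree G v = Σv (λ u → bit (adj G v u))

edgeCount : ∀ {n} → Graph n → ℕ
edgeCount G = Σv (λ u → Σv (λ v → bit ((toℕ u <ᵇ toℕ v) ∧ adj G u v)))

data PathIn {n} (G : Graph n) (S : Subset n) : Fin n → Fin n → Set where
  here : ∀ {u} → u ∈ S → PathIn G S u u
  step : ∀ {u w v} → u ∈ S → adj G u w ≡ true → PathIn G S w v → PathIn G S u v

ConnectedIn : ∀ {n} → Graph n → Subset n → Set
ConnectedIn G S = ∀ u v → u ∈ S → v ∈ S → PathIn G S u v

IsTree : ∀ {n} → Graph n → Set
IsTree {n} G = ConnectedIn G (Data.Fin.Subset.⊤) × (edgeCount G + 1 ≡ n)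

IsSubtree : ∀ {n} → Graph n → Subset n → Set
IsSubtree G S = Nonempty S × ConnectedIn G S

crossEdges : ∀ {n} → Graph n → Subset n → ℕ
crossEdges G S = Σv (λ u → Σv (λ v → bit (Data.Vec.lookup S u ∧ not (Data.Vec.lookup S v) ∧ adj G u v)))

module Submission where

-- The rational hypotheses only serve to give the integer bounds 1 ≤ b and
-- Δb + m < n (RationalBounds).  Write b = c + 1.
--
-- We contract T step by step.  A contraction
-- is an owner map o whose fixed points, the roots, represent connected bags
-- o⁻¹(v); edges between distinct bags join their roots, the contracted graph
-- on the roots is a tree (recorded numerically: its degree sum is
-- 2·#roots - 2), and every bag obeys |bag v| + c·deg(v) ≤ 1 + Δc.  Initially
-- every vertex is its own bag.  The contracted tree has a leaf ℓ with unique
-- neighbour p.  If |bag ℓ| ≥ c + 1, bag ℓ is T₁: its size lies in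
-- [c + 1, 1 + Δc] and its only outgoing edge is ℓp.  Otherwise bag ℓ is merged
-- into bag p, which keeps all invariants and removes one root.
--
-- Large subtree (Walks).  In a connected graph a connected vertex set can be
-- grown one neighbouring vertex at a time to any size up to n; growing T₁ to
-- n - m vertices gives T′.

open import Data.Nat using (ℕ)
open import Defs using (Graph)

module RationalBounds where

  open import Defs using (ℕtoℚ)
  open import Data.Nat as ℕ using (ℕ; suc; NonZero)
  open import Data.Integer as ℤ using (+_)
  import Data.Integer.Properties as ℤ
  open import Data.Rational using (ℚ; mkℚ; toℚᵘ; 0ℚ; 1ℚ; _<_; _+_; _*_; *<*; Positive)
  open import Data.Rational.Properties
  import Data.Rational.Unnormalised as ℚᵘ
  import Data.Rational.Unnormalised.Properties as ℚᵘ
  import Data.Nat.Coprimality as Coprime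
  open import Data.Product using (_×_; _,_)
  open import Relation.Binary.PropositionalEquality

  ℕtoℚ-normal : ∀ x → ℕtoℚ x ≡ mkℚ (+ x) 0 (Coprime.sym (Coprime.1-coprimeTo x))
  ℕtoℚ-normal x = normalize-coprime (Coprime.sym (Coprime.1-coprimeTo x))

  ℕtoℚ-+ : ∀ x y → ℕtoℚ (x ℕ.+ y) ≡ ℕtoℚ x + ℕtoℚ y
  ℕtoℚ-+ x y = toℚᵘ-injective (ℚᵘ.≃-trans unnormalised (ℚᵘ.≃-sym (toℚᵘ-homo-+ (ℕtoℚ x) (ℕtoℚ y))))
    where
    unnormalised : toℚᵘ (ℕtoℚ (x ℕ.+ y)) ℚᵘ.≃ (toℚᵘ (ℕtoℚ x) ℚᵘ.+ toℚᵘ (ℕtoℚ y))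
    unnormalised rewrite ℕtoℚ-normal x | ℕtoℚ-normal y | ℕtoℚ-normal (x ℕ.+ y) =
      ℚᵘ.*≡* (cong (ℤ._* + 1) (trans (ℤ.pos-+ x y) (sym (cong₂ ℤ._+_ (ℤ.*-identityʳ (+ x)) (ℤ.*-identityʳ (+ y))))))

  ℕtoℚ-* : ∀ x y → ℕtoℚ (x ℕ.* y) ≡ ℕtoℚ x * ℕtoℚ y
  ℕtoℚ-* x y = toℚᵘ-injective (ℚᵘ.≃-trans unnormalised (ℚᵘ.≃-sym (toℚᵘ-homo-* (ℕtoℚ x) (ℕtoℚ y))))
    where
    unnormalised : toℚᵘ (ℕtoℚ (x ℕ.* y)) ℚᵘ.≃ (toℚᵘ (ℕtoℚ x) ℚᵘ.* toℚᵘ (ℕtoℚ y))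
    unnormalised rewrite ℕtoℚ-normal x | ℕtoℚ-normal y | ℕtoℚ-normal (x ℕ.* y) =
      ℚᵘ.*≡* (cong (ℤ._* + 1) (ℤ.pos-* x y))

  ℕtoℚ-cancel-< : ∀ x y → ℕtoℚ x < ℕtoℚ y → x ℕ.< y
  ℕtoℚ-cancel-< x y x<y rewrite ℕtoℚ-normal x | ℕtoℚ-normal y with x<y
  ... | *<* x*1<y*1 = ℤ.drop‿+<+ (subst₂ ℤ._<_ (ℤ.*-identityʳ (+ x)) (ℤ.*-identityʳ (+ y)) x*1<y*1)

  ℕtoℚ-positive : ∀ x → .{{NonZero x}} → Positive (ℕtoℚ x)
  ℕtoℚ-positive (suc x) rewrite ℕtoℚ-normal (suc x) = _

  -- If βn = b and γn = m are integers with β > 0 and Δβ + γ < 1, then 1 ≤ b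
  -- and Δb + m < n: multiply both hypotheses by n > 0.
  integerBounds : (β γ : ℚ) (n Δ b m : ℕ) → .{{NonZero n}} → 0ℚ < β → ℕtoℚ Δ * β + γ < 1ℚ →
                  β * ℕtoℚ n ≡ ℕtoℚ b → γ * ℕtoℚ n ≡ ℕtoℚ m → 1 ℕ.≤ b × Δ ℕ.* b ℕ.+ m ℕ.< n
  integerBounds β γ n Δ b m β>0 Δβ+γ<1 βn≡b γn≡m =
    ℕtoℚ-cancel-< 0 b 0<b , ℕtoℚ-cancel-< (Δ ℕ.* b ℕ.+ m) n Δb+m<n
    where
    instance
      n-positive : Positive (ℕtoℚ n)
      n-positive = ℕtoℚ-positive n
    0<b : 0ℚ < ℕtoℚ b
    0<b = subst₂ _<_ (*-zeroˡ (ℕtoℚ n)) βn≡b (*-monoˡ-<-pos (ℕtoℚ n) β>0)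
    scaled : (ℕtoℚ Δ * β + γ) * ℕtoℚ n ≡ ℕtoℚ (Δ ℕ.* b ℕ.+ m)
    scaled = begin
      (ℕtoℚ Δ * β + γ) * ℕtoℚ n           ≡⟨ *-distribʳ-+ (ℕtoℚ n) (ℕtoℚ Δ * β) γ ⟩
      ℕtoℚ Δ * β * ℕtoℚ n + γ * ℕtoℚ n    ≡⟨ cong₂ _+_ (trans (*-assoc (ℕtoℚ Δ) β (ℕtoℚ n)) (cong (ℕtoℚ Δ *_) βn≡b)) γn≡m ⟩
      ℕtoℚ Δ * ℕtoℚ b + ℕtoℚ m            ≡⟨ cong (_+ ℕtoℚ m) (ℕtoℚ-* Δ b) ⟨
      ℕtoℚ (Δ ℕ.* b) + ℕtoℚ m             ≡⟨ ℕtoℚ-+ (Δ ℕ.* b) m ⟨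
      ℕtoℚ (Δ ℕ.* b ℕ.+ m)                ∎
      where open ≡-Reasoning
    Δb+m<n : ℕtoℚ (Δ ℕ.* b ℕ.+ m) < ℕtoℚ n
    Δb+m<n = subst₂ _<_ scaled (*-identityˡ (ℕtoℚ n)) (*-monoˡ-<-pos (ℕtoℚ n) Δβ+γ<1)


-- Sums over Fin n, with the standard library's semiring sum ∑ as the
-- reference notion; Defs sums over the list allFin n instead.
module FiniteSums where

  open import Defs using (Σv)
  open import Data.Nat
  open import Data.Nat.Properties
  open import Data.Fin using (Fin; zero; suc; punchIn; punchOut)
  open import Data.Fin.Properties using (punchInᵢ≢i; punchIn-punchOut)
  open import Data.List using (tabulate)
  open import Data.List.Properties using (map-tabulate)
  import Data.Nat.ListAction as List
  open import Relation.Binary.PropositionalEquality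
  open import Function using (_∘_; id)

  open import Algebra.Properties.Semiring.Sum +-*-semiring public
    using (sum-cong-≗; ∑-distrib-+; ∑-comm; *-distribˡ-sum)
    renaming (sum to ∑)
  open import Algebra.Properties.Semiring.Sum +-*-semiring using (sum-remove)

  Σv≡∑ : ∀ {n} (f : Fin n → ℕ) → Σv f ≡ ∑ f
  Σv≡∑ {n} f = trans (cong List.sum (map-tabulate {n = n} id f)) (listSum f)
    where
    listSum : ∀ {k} (g : Fin k → ℕ) → List.sum (tabulate g) ≡ ∑ g
    listSum {zero} g = refl
    listSum {suc k} g = cong (g zero +_) (listSum (g ∘ suc))

  ∑-mono-≤ : ∀ {n} {f g : Fin n → ℕ} → (∀ x → f x ≤ g x) → ∑ f ≤ ∑ g
  ∑-mono-≤ {zero} f≤g = ≤-refl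
  ∑-mono-≤ {suc n} f≤g = +-mono-≤ (f≤g zero) (∑-mono-≤ (f≤g ∘ suc))

  ∑-const : ∀ {n} k → ∑ {n} (λ _ → k) ≡ n * k
  ∑-const {zero} k = refl
  ∑-const {suc n} k = cong (k +_) (∑-const {n} k)

  ∑-differ-at : ∀ {n} (a : Fin n) {f g : Fin n → ℕ} d → (∀ x → x ≢ a → f x ≡ g x) → f a ≡ d + g a → ∑ f ≡ d + ∑ g
  ∑-differ-at {suc n} a {f} {g} d agree fa≡d+ga = begin
    ∑ f                            ≡⟨ sum-remove f ⟩
    f a + ∑ (f ∘ punchIn a)        ≡⟨ cong₂ _+_ fa≡d+ga (sum-cong-≗ (λ x → agree (punchIn a x) (punchInᵢ≢i a x))) ⟩
    d + g a + ∑ (g ∘ punchIn a)    ≡⟨ +-assoc d (g a) _ ⟩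
    d + (g a + ∑ (g ∘ punchIn a))  ≡⟨ cong (d +_) (sum-remove g) ⟨
    d + ∑ g                        ∎
    where open ≡-Reasoning

  ∑-single : ∀ {n} (a : Fin n) (f : Fin n → ℕ) → (∀ x → x ≢ a → f x ≡ 0) → ∑ f ≡ f a
  ∑-single {n} a f vanish = begin
    ∑ f                   ≡⟨ ∑-differ-at a (f a) vanish (sym (+-identityʳ (f a))) ⟩
    f a + ∑ {n} (λ _ → 0)  ≡⟨ cong (f a +_) (trans (∑-const {n} 0) (*-zeroʳ n)) ⟩
    f a + 0               ≡⟨ +-identityʳ (f a) ⟩
    f a                   ∎
    where open ≡-Reasoning

  ∑-≥-term : ∀ {n} (a : Fin n) (f : Fin n → ℕ) → f a ≤ ∑ f
  ∑-≥-term {suc n} a f = subst (f a ≤_) (sym (sum-remove f)) (m≤m+n (f a) _)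

  ∑-≥-two-terms : ∀ {n} {a b : Fin n} (f : Fin n → ℕ) → a ≢ b → f a + f b ≤ ∑ f
  ∑-≥-two-terms {suc n} {a} {b} f a≢b = begin
    f a + f b                            ≡⟨ cong (λ x → f a + f x) (punchIn-punchOut a≢b) ⟨
    f a + f (punchIn a (punchOut a≢b))   ≤⟨ +-monoʳ-≤ (f a) (∑-≥-term (punchOut a≢b) (f ∘ punchIn a)) ⟩
    f a + ∑ (f ∘ punchIn a)              ≡⟨ sum-remove f ⟨
    ∑ f                                  ∎
    where open ≤-Reasoning


-- Vertex sets as Boolean predicates P : Fin n → Bool; they become the
-- Subset n = Vec Bool n of the statement by tabulation.
module VertexSets where

  open import Defs using (bit)
  open FiniteSums
  open import Data.Nat using (ℕ; zero; suc)
  open import Data.Nat.Properties using (*-identityʳ)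
  open import Data.Fin using (Fin; zero; suc; _≟_)
  open import Data.Bool using (Bool; true; false)
  open import Data.Fin.Subset using (_∈_; ∣_∣)
  import Data.Vec as V
  import Data.Vec.Properties as V
  open import Relation.Nullary using (does; yes)
  open import Relation.Nullary.Decidable using (dec-true; dec-false)
  open import Relation.Binary.PropositionalEquality
  open import Function using (_∘_)

  _==_ : ∀ {n} → Fin n → Fin n → Bool
  u == v = does (u ≟ v)

  ==-sound : ∀ {n} {u v : Fin n} → u == v ≡ true → u ≡ v
  ==-sound {u = u} {v} u==v with u ≟ v
  ... | yes u≡v = u≡v

  ==-complete : ∀ {n} {u v : Fin n} → u ≡ v → u == v ≡ true
  ==-complete {u = u} {v} = dec-true (u ≟ v)

  ==-distinct : ∀ {n} {u v : Fin n} → u ≢ v → u == v ≡ false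
  ==-distinct {u = u} {v} = dec-false (u ≟ v)

  separated : ∀ {n} (P : Fin n → Bool) {x y} → P x ≡ true → P y ≡ false → x ≢ y
  separated P Px Py refl with trans (sym Px) Py
  ... | ()

  _⊆ᵇ_ : ∀ {n} → (Fin n → Bool) → (Fin n → Bool) → Set
  P ⊆ᵇ Q = ∀ z → P z ≡ true → Q z ≡ true

  count : ∀ {n} → (Fin n → Bool) → ℕ
  count P = ∑ (bit ∘ P)

  count-full : ∀ {n} (P : Fin n → Bool) → (∀ x → P x ≡ true) → count P ≡ n
  count-full {n} P full = trans (sum-cong-≗ (cong bit ∘ full)) (trans (∑-const {n} 1) (*-identityʳ n))

  count-tabulate : ∀ {n} (P : Fin n → Bool) → ∣ V.tabulate P ∣ ≡ count P
  count-tabulate {zero} P = refl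
  count-tabulate {suc n} P with P zero
  ... | true = cong suc (count-tabulate (P ∘ suc))
  ... | false = count-tabulate (P ∘ suc)

  ∈-tabulate⁺ : ∀ {n} (P : Fin n → Bool) x → P x ≡ true → x ∈ V.tabulate P
  ∈-tabulate⁺ P x Px = V.lookup⇒[]= x (V.tabulate P) (trans (V.lookup∘tabulate P x) Px)

  ∈-tabulate⁻ : ∀ {n} (P : Fin n → Bool) x → x ∈ V.tabulate P → P x ≡ true
  ∈-tabulate⁻ P x x∈P = trans (sym (V.lookup∘tabulate P x)) (V.[]=⇒lookup x∈P)


module Walks {n : ℕ} (G : Graph n) where

  open import Defs hiding (sym)
  open FiniteSums
  open VertexSets
  open import Data.Nat
  open import Data.Nat.Properties
  open import Data.Fin using (Fin)
  import Data.Fin.Properties as Fin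
  open import Data.Bool using (Bool; true; false; _∧_; _∨_; not)
  import Data.Bool.Properties as Bool
  open import Data.Product
  open import Data.Empty
  open import Relation.Nullary
  open import Relation.Binary.PropositionalEquality
  import Data.Vec as V
  import Data.Vec.Properties as V
  import Data.Fin.Subset as Subset
  import Data.Fin.Subset.Properties as Subset

  data Walk (P : Fin n → Bool) : Fin n → Fin n → Set where
    here : ∀ {u} → P u ≡ true → Walk P u u
    step : ∀ {u w v} → P u ≡ true → adj G u w ≡ true → Walk P w v → Walk P u v

  walk-mono : ∀ {P Q x y} → P ⊆ᵇ Q → Walk P x y → Walk Q x y
  walk-mono P⊆Q (here Pu) = here (P⊆Q _ Pu)
  walk-mono P⊆Q (step Pu u~w rest) = step (P⊆Q _ Pu) u~w (walk-mono P⊆Q rest)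

  walk-snoc : ∀ {P x y z} → Walk P x y → adj G y z ≡ true → P z ≡ true → Walk P x z
  walk-snoc (here Px) y~z Pz = step Px y~z (here Pz)
  walk-snoc (step Px x~w rest) y~z Pz = step Px x~w (walk-snoc rest y~z Pz)

  walk-++ : ∀ {P x y z} → Walk P x y → Walk P y z → Walk P x z
  walk-++ (here _) second = second
  walk-++ (step Px x~w rest) second = step Px x~w (walk-++ rest second)

  walk-reverse : ∀ {P x y} → Walk P x y → Walk P y x
  walk-reverse (here Px) = here Px
  walk-reverse (step Px x~w rest) = walk-snoc (walk-reverse rest) (trans (Graph.sym G _ _) x~w) Px

  walk⇒path : ∀ {P x y} → Walk P x y → PathIn G (V.tabulate P) x y
  walk⇒path (here Px) = here (∈-tabulate⁺ _ _ Px)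
  walk⇒path (step Px x~w rest) = step (∈-tabulate⁺ _ _ Px) x~w (walk⇒path rest)

  ConnectedFrom : (Fin n → Bool) → Fin n → Set
  ConnectedFrom P a = ∀ x → P x ≡ true → Walk P a x

  asSubtree : ∀ {P a} → P a ≡ true → ConnectedFrom P a → IsSubtree G (V.tabulate P)
  asSubtree {P} {a} Pa reach = (a , ∈-tabulate⁺ P a Pa) , connected
    where
    connected : ConnectedIn G (V.tabulate P)
    connected u v u∈P v∈P =
      walk⇒path (walk-++ (walk-reverse (reach u (∈-tabulate⁻ P u u∈P))) (reach v (∈-tabulate⁻ P v v∈P)))

  leavingEdge : ∀ {S x z} (P : Fin n → Bool) → PathIn G S x z → P x ≡ true → P z ≡ false →
                Σ (Fin n) λ u → Σ (Fin n) λ w → P u ≡ true × P w ≡ false × adj G u w ≡ true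
  leavingEdge P (here _) Px Pz with trans (sym Px) Pz
  ... | ()
  leavingEdge P (step {w = w} _ x~w rest) Px Pz with P w in Pw
  ... | true = leavingEdge P rest Pw Pz
  ... | false = _ , w , Px , Pw , x~w

  missedVertex : (P : Fin n → Bool) → count P < n → Σ (Fin n) λ z → P z ≡ false
  missedVertex P small with Fin.any? (λ z → P z Bool.≟ false)
  ... | yes missed = missed
  ... | no ¬missed = ⊥-elim (<-irrefl (count-full P full) small)
    where
    full : ∀ z → P z ≡ true
    full z with P z in Pz
    ... | true = refl
    ... | false = ⊥-elim (¬missed (z , Pz))

  record Extension (P : Fin n → Bool) (a : Fin n) (s : ℕ) : Set where
    field
      extension           : Fin n → Bool
      ⊆extension          : P ⊆ᵇ extension
      extension-connected : ConnectedFrom extension a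
      extension-size      : count extension ≡ s
  open Extension

  -- In a connected graph, a connected proper vertex set has a connected
  -- superset with one more vertex: add the far end of a leaving edge.
  addNeighbour : ConnectedIn G Subset.⊤ → (P : Fin n → Bool) (a : Fin n) → P a ≡ true → ConnectedFrom P a →
                 count P < n → Extension P a (suc (count P))
  addNeighbour G-connected P a Pa reach small
    with missedVertex P small
  ... | z , Pz with leavingEdge P (G-connected a z Subset.∈⊤ Subset.∈⊤) Pa Pz
  ... | x , w , Px , Pw , x~w = record
    { extension = Q ; ⊆extension = P⊆Q ; extension-connected = reachQ ; extension-size = countQ }
    where
    Q : Fin n → Bool
    Q y = P y ∨ (y == w)
    P⊆Q : P ⊆ᵇ Q
    P⊆Q y Py rewrite Py = refl
    Qw : Q w ≡ true
    Qw rewrite ==-complete {u = w} refl = Bool.∨-zeroʳ (P w)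
    reachQ : ConnectedFrom Q a
    reachQ y Qy with P y in Py
    ... | true = walk-mono P⊆Q (reach y Py)
    ... | false with ==-sound {u = y} {v = w} Qy
    ... | refl = walk-snoc (walk-mono P⊆Q (reach x Px)) x~w Qw
    countQ : count Q ≡ suc (count P)
    countQ = ∑-differ-at w 1
      (λ y y≢w → cong bit (trans (cong (P y ∨_) (==-distinct y≢w)) (Bool.∨-identityʳ (P y))))
      (subst₂ (λ s t → bit s ≡ 1 + bit t) (sym Qw) (sym Pw) refl)

  growConnected : ConnectedIn G Subset.⊤ → (k : ℕ) (P : Fin n → Bool) (a : Fin n) → P a ≡ true →
                  ConnectedFrom P a → count P + k ≤ n → Extension P a (count P + k)
  growConnected G-connected zero P a Pa reach fits = record
    { extension = P ; ⊆extension = λ _ Pz → Pz ; extension-connected = reach ; extension-size = sym (+-identityʳ _) }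
  growConnected G-connected (suc k) P a Pa reach fits = record
    { extension           = extension R
    ; ⊆extension          = λ z Pz → ⊆extension R z (⊆extension Q z Pz)
    ; extension-connected = extension-connected R
    ; extension-size      = trans (extension-size R) (trans (cong (_+ k) (extension-size Q)) (sym (+-suc (count P) k)))
    }
    where
    fits′ : suc (count P) + k ≤ n
    fits′ = subst (_≤ n) (+-suc (count P) k) fits
    Q = addNeighbour G-connected P a Pa reach (≤-trans (s≤s (m≤m+n (count P) k)) fits′)
    R = growConnected G-connected k (extension Q) a (⊆extension Q a Pa) (extension-connected Q)
                      (subst (λ s → s + k ≤ n) (sym (extension-size Q)) fits′)

  growTo : ConnectedIn G Subset.⊤ → (P : Fin n → Bool) (a : Fin n) → P a ≡ true → ConnectedFrom P a →
           ∀ {s} → count P ≤ s → s ≤ n → Extension P a s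
  growTo G-connected P a Pa reach {s} P≤s s≤n =
    subst (Extension P a) (m+[n∸m]≡n P≤s)
          (growConnected G-connected (s ∸ count P) P a Pa reach (subst (_≤ n) (sym (m+[n∸m]≡n P≤s)) s≤n))

  singleCrossing : (P : Fin n → Bool) (ℓ p : Fin n) → P ℓ ≡ true → P p ≡ false → adj G ℓ p ≡ true →
                   (∀ u w → P u ≡ true → P w ≡ false → adj G u w ≡ true → u ≡ ℓ × w ≡ p) →
                   crossEdges G (V.tabulate P) ≡ 1
  singleCrossing P ℓ p Pℓ Pp ℓ~p onlyEdge = begin
    crossEdges G (V.tabulate P)        ≡⟨ Σv≡∑ (λ u → Σv (crossingᵛ u)) ⟩
    ∑ (λ u → Σv (λ w → crossingᵛ u w)) ≡⟨ sum-cong-≗ (λ u → trans (Σv≡∑ (crossingᵛ u)) (sum-cong-≗ (untabulate u))) ⟩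
    ∑ (λ u → ∑ (crossing u))           ≡⟨ ∑-single ℓ _ (λ u u≢ℓ → ∑-zero (λ w → noCrossing u w (λ u≡ℓ _ → u≢ℓ u≡ℓ))) ⟩
    ∑ (crossing ℓ)                     ≡⟨ ∑-single p _ (λ w w≢p → noCrossing ℓ w (λ _ w≡p → w≢p w≡p)) ⟩
    crossing ℓ p                       ≡⟨ cong₂ (λ s t → bit (s ∧ not t ∧ adj G ℓ p)) Pℓ Pp ⟩
    bit (adj G ℓ p)                    ≡⟨ cong bit ℓ~p ⟩
    1                                  ∎
    where
    open ≡-Reasoning
    crossingᵛ crossing : Fin n → Fin n → ℕ
    crossingᵛ u w = bit (V.lookup (V.tabulate P) u ∧ not (V.lookup (V.tabulate P) w) ∧ adj G u w)
    crossing u w = bit (P u ∧ not (P w) ∧ adj G u w)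
    untabulate : ∀ u w → crossingᵛ u w ≡ crossing u w
    untabulate u w = cong₂ (λ s t → bit (s ∧ not t ∧ adj G u w)) (V.lookup∘tabulate P u) (V.lookup∘tabulate P w)
    ∑-zero : ∀ {f : Fin n → ℕ} → (∀ w → f w ≡ 0) → ∑ f ≡ 0
    ∑-zero {f} vanish = trans (sum-cong-≗ vanish) (trans (∑-const {n} 0) (*-zeroʳ n))
    noCrossing : ∀ u w → (u ≡ ℓ → w ≡ p → ⊥) → crossing u w ≡ 0
    noCrossing u w notℓp with P u in Pu | P w in Pw | adj G u w in u~w
    ... | true  | false | true  = ⊥-elim (uncurry notℓp (onlyEdge u w Pu Pw u~w))
    ... | true  | false | false = refl
    ... | true  | true  | _     = refl
    ... | false | _     | _     = refl

  record PendantSubtree (lo hi : ℕ) : Set where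
    field
      members   : Fin n → Bool
      root      : Fin n
      root∈     : members root ≡ true
      connected : ConnectedFrom members root
      lower     : lo ≤ count members
      upper     : count members ≤ hi
      pendant   : crossEdges G (V.tabulate members) ≡ 1


module Handshake {n : ℕ} (G : Graph n) where

  open import Defs hiding (sym)
  open FiniteSums
  open import Data.Nat
  open import Data.Nat.Properties
  open import Data.Fin using (Fin; toℕ)
  import Data.Fin.Properties as Fin
  open import Data.Bool using (_∧_)
  import Data.Bool.Properties as Bool
  open import Relation.Nullary.Decidable using (dec-true; dec-false)
  open import Relation.Binary.Definitions using (tri<; tri≈; tri>)
  open import Relation.Binary.PropositionalEquality

  ordered : Fin n → Fin n → ℕ
  ordered u v = bit ((toℕ u <ᵇ toℕ v) ∧ adj G u v)

  adjacency-split : ∀ u v → bit (adj G u v) ≡ ordered u v + ordered v u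
  adjacency-split u v with Fin.<-cmp u v
  ... | tri< u<v _ v≮u rewrite dec-true (toℕ u <? toℕ v) u<v | dec-false (toℕ v <? toℕ u) v≮u =
    sym (+-identityʳ _)
  ... | tri> u≮v _ v<u rewrite dec-true (toℕ v <? toℕ u) v<u | dec-false (toℕ u <? toℕ v) u≮v | Graph.sym G v u =
    refl
  ... | tri≈ _ refl _ rewrite Graph.irrefl G u | Bool.∧-zeroʳ (toℕ u <ᵇ toℕ u) = refl

  handshake : ∑ (λ u → ∑ (λ v → bit (adj G u v))) ≡ edgeCount G + edgeCount G
  handshake = begin
    ∑ (λ u → ∑ (λ v → bit (adj G u v)))                                ≡⟨ sum-cong-≗ (λ u → sum-cong-≗ (adjacency-split u)) ⟩
    ∑ (λ u → ∑ (λ v → ordered u v + ordered v u))                      ≡⟨ sum-cong-≗ (λ u → ∑-distrib-+ (ordered u) (λ v → ordered v u)) ⟩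
    ∑ (λ u → ∑ (ordered u) + ∑ (λ v → ordered v u))                    ≡⟨ ∑-distrib-+ (λ u → ∑ (ordered u)) _ ⟩
    ∑ (λ u → ∑ (ordered u)) + ∑ (λ u → ∑ (λ v → ordered v u))          ≡⟨ cong (∑ (λ u → ∑ (ordered u)) +_) (∑-comm (λ v u → ordered v u)) ⟨
    ∑ (λ u → ∑ (ordered u)) + ∑ (λ v → ∑ (ordered v))                  ≡⟨ cong₂ _+_ edges edges ⟨
    edgeCount G + edgeCount G                                          ∎
    where
    open ≡-Reasoning
    edges : edgeCount G ≡ ∑ (λ u → ∑ (ordered u))
    edges = trans (Σv≡∑ (λ u → Σv (ordered u))) (sum-cong-≗ (λ u → Σv≡∑ (ordered u)))


module Contraction {n : ℕ} (G : Graph n) (Δ c : ℕ) where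

  open import Defs hiding (sym)
  open FiniteSums
  open VertexSets
  open Walks G
  open Handshake G
  open import Data.Nat hiding (_≟_)
  open import Data.Nat.Properties hiding (_≟_)
  open import Data.Nat.Tactic.RingSolver using (solve-∀)
  open import Data.Fin using (Fin; _≟_)
  import Data.Fin.Properties as Fin
  open import Data.Bool using (Bool; true; false; _∧_; if_then_else_)
  import Data.Bool.Properties as Bool
  open import Data.Product
  open import Data.Sum using (_⊎_; inj₁; inj₂)
  open import Data.Empty
  open import Relation.Nullary
  open import Relation.Nullary.Decidable using (_×-dec_; ¬?)
  open import Relation.Binary.PropositionalEquality
  open import Function using (id; _∘_)
  import Data.Fin.Subset as Subset
  import Data.Fin.Subset.Properties as Subset

  -- o u is the root of the bag containing u; the bag of a root v is the set
  -- of vertices owned by v.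
  Owner : Set
  Owner = Fin n → Fin n

  isRoot : Owner → Fin n → Bool
  isRoot o v = o v == v

  bag : Owner → Fin n → Fin n → Bool
  bag o v u = o u == v

  bagSize : Owner → Fin n → ℕ
  bagSize o v = count (bag o v)

  -- The number of roots adjacent to v; for a root v this is its degree in
  -- the contracted graph, because edges between bags join their roots.
  rootDegree : Owner → Fin n → ℕ
  rootDegree o v = ∑ (λ u → bit (adj G v u ∧ isRoot o u))

  rootCount : Owner → ℕ
  rootCount o = count (isRoot o)

  rootDegreeSum : Owner → ℕ
  rootDegreeSum o = ∑ (λ v → bit (isRoot o v) * rootDegree o v)

  -- The invariants of a contraction.  The degree-sum identity expresses that
  -- the contracted graph, being connected, is a tree.
  record Valid (o : Owner) : Set where
    field
      idempotent     : ∀ u → o (o u) ≡ o u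
      bag-connected  : ∀ v → o v ≡ v → ConnectedFrom (bag o v) v
      edges-at-roots : ∀ u w → adj G u w ≡ true → o u ≢ o w → o u ≡ u × o w ≡ w
      bag-bound      : ∀ v → o v ≡ v → bagSize o v + c * rootDegree o v ≤ 1 + Δ * c
      degree-sum     : rootDegreeSum o + 2 ≡ 2 * rootCount o

  record Leaf (o : Owner) : Set where
    field
      ℓ p      : Fin n
      ℓ-root   : o ℓ ≡ ℓ
      p-root   : o p ≡ p
      p≢ℓ      : p ≢ ℓ
      ℓ~p      : adj G ℓ p ≡ true
      ℓ-degree : rootDegree o ℓ ≡ 1
      p-unique : ∀ z → adj G ℓ z ≡ true → o z ≡ z → z ≡ p

  -- Initially every vertex is its own bag.  The degree sum is then the
  -- handshake identity for the tree G, and each bag bound is the degree bound.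
  trivial-valid : (∀ v → degree G v ≤ Δ) → edgeCount G + 1 ≡ n → Valid id
  trivial-valid degree≤Δ edges = record
    { idempotent     = λ _ → refl
    ; bag-connected  = singleton-connected
    ; edges-at-roots = λ _ _ _ _ → refl , refl
    ; bag-bound      = λ v _ → singleton-bound v
    ; degree-sum     = degree-sum-id
    }
    where
    isRoot-id : ∀ v → isRoot id v ≡ true
    isRoot-id v = ==-complete {u = v} refl
    singleton-connected : ∀ v → v ≡ v → ConnectedFrom (bag id v) v
    singleton-connected v _ x x∈ with ==-sound {u = x} {v = v} x∈
    ... | refl = here x∈
    singleton-size : ∀ v → bagSize id v ≡ 1
    singleton-size v = trans (∑-single v _ (λ _ u≢v → cong bit (==-distinct u≢v))) (cong bit (isRoot-id v))
    rootDegree-id : ∀ v → rootDegree id v ≡ ∑ (λ u → bit (adj G v u))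
    rootDegree-id v = sum-cong-≗ (λ u → trans (cong (λ t → bit (adj G v u ∧ t)) (isRoot-id u)) (cong bit (Bool.∧-identityʳ _)))
    singleton-bound : ∀ v → bagSize id v + c * rootDegree id v ≤ 1 + Δ * c
    singleton-bound v = begin
      bagSize id v + c * rootDegree id v     ≡⟨ cong₂ (λ s d → s + c * d) (singleton-size v) (rootDegree-id v) ⟩
      1 + c * ∑ (λ u → bit (adj G v u))      ≡⟨ cong (λ d → 1 + c * d) (Σv≡∑ (λ u → bit (adj G v u))) ⟨
      1 + c * degree G v                     ≤⟨ s≤s (*-monoʳ-≤ c (degree≤Δ v)) ⟩
      1 + c * Δ                              ≡⟨ cong (1 +_) (*-comm c Δ) ⟩
      1 + Δ * c                              ∎
      where open ≤-Reasoning
    degree-sum-id : rootDegreeSum id + 2 ≡ 2 * rootCount id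
    degree-sum-id = begin
      rootDegreeSum id + 2                        ≡⟨ cong (_+ 2) (sum-cong-≗ (λ v → trans (cong (λ t → bit t * rootDegree id v) (isRoot-id v))
                                                                                 (trans (+-identityʳ _) (rootDegree-id v)))) ⟩
      ∑ (λ u → ∑ (λ v → bit (adj G u v))) + 2     ≡⟨ cong (_+ 2) handshake ⟩
      edgeCount G + edgeCount G + 2               ≡⟨ double (edgeCount G) ⟩
      2 * (edgeCount G + 1)                       ≡⟨ cong (2 *_) (trans edges (sym (count-full (isRoot id) isRoot-id))) ⟩
      2 * rootCount id                            ∎
      where
      open ≡-Reasoning
      double : ∀ e → e + e + 2 ≡ 2 * (e + 1)
      double = solve-∀

  -- Merging the bag of a leaf ℓ into the bag of its neighbour p.  When bag ℓ
  -- has at most c vertices, the merged bag p still satisfies its bound: it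
  -- gains at most c vertices and loses the neighbour ℓ.
  module Merge {o : Owner} (V : Valid o) (L : Leaf o) (light : bagSize o (Leaf.ℓ L) ≤ c) where
    open Valid V
    open Leaf L

    redirect : Fin n → Fin n
    redirect y = if y == ℓ then p else y

    o′ : Owner
    o′ u = redirect (o u)

    redirect-ℓ : ∀ {y} → y ≡ ℓ → redirect y ≡ p
    redirect-ℓ {y} y≡ℓ = cong (λ b → if b then p else y) (==-complete y≡ℓ)

    redirect-other : ∀ {y} → y ≢ ℓ → redirect y ≡ y
    redirect-other {y} y≢ℓ = cong (λ b → if b then p else y) (==-distinct y≢ℓ)

    moved-or-kept : ∀ u → (o u ≡ ℓ × o′ u ≡ p) ⊎ (o u ≢ ℓ × o′ u ≡ o u)
    moved-or-kept u = classify (o u ≟ ℓ)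
      where
      classify : Dec (o u ≡ ℓ) → (o u ≡ ℓ × o′ u ≡ p) ⊎ (o u ≢ ℓ × o′ u ≡ o u)
      classify (yes ou≡ℓ) = inj₁ (ou≡ℓ , redirect-ℓ ou≡ℓ)
      classify (no ou≢ℓ)  = inj₂ (ou≢ℓ , redirect-other ou≢ℓ)

    o′-root : ∀ v → o v ≡ v → v ≢ ℓ → o′ v ≡ v
    o′-root v v-root v≢ℓ = trans (redirect-other (λ ov≡ℓ → v≢ℓ (trans (sym v-root) ov≡ℓ))) v-root

    o′-p : o′ p ≡ p
    o′-p = o′-root p p-root p≢ℓ

    o′-ℓ : o′ ℓ ≡ p
    o′-ℓ = redirect-ℓ ℓ-root

    idempotent′ : ∀ u → o′ (o′ u) ≡ o′ u
    idempotent′ u with moved-or-kept u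
    ... | inj₁ (_ , o′u≡p) = trans (cong o′ o′u≡p) (trans o′-p (sym o′u≡p))
    ... | inj₂ (ou≢ℓ , o′u≡ou) = trans (cong o′ o′u≡ou) (trans (o′-root (o u) (idempotent u) ou≢ℓ) (sym o′u≡ou))

    new-root : ∀ v → o′ v ≡ v → o v ≡ v × v ≢ ℓ
    new-root v o′v≡v with moved-or-kept v
    ... | inj₁ (_ , o′v≡p) = subst (λ t → o t ≡ t × t ≢ ℓ) (trans (sym o′v≡p) o′v≡v) (p-root , p≢ℓ)
    ... | inj₂ (ov≢ℓ , o′v≡ov) = ov≡v , λ v≡ℓ → ov≢ℓ (trans ov≡v v≡ℓ)
      where ov≡v = trans (sym o′v≡ov) o′v≡v

    stays : ∀ v → v ≢ ℓ → ∀ z → o z ≡ v → o′ z ≡ v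
    stays v v≢ℓ z oz≡v with moved-or-kept z
    ... | inj₁ (oz≡ℓ , _) = ⊥-elim (v≢ℓ (trans (sym oz≡v) oz≡ℓ))
    ... | inj₂ (_ , o′z≡oz) = trans o′z≡oz oz≡v

    -- Bag p absorbs the connected bag ℓ through the edge pℓ; other bags are unchanged.
    bag-connected′ : ∀ v → o′ v ≡ v → ConnectedFrom (bag o′ v) v
    bag-connected′ v o′v≡v x x∈ with v ≟ p
    ... | no v≢p = walk-mono (λ z z∈ → ==-complete (stays v v≢ℓ z (==-sound z∈))) (bag-connected v v-root x x∈old)
      where
      v-root = proj₁ (new-root v o′v≡v)
      v≢ℓ = proj₂ (new-root v o′v≡v)
      x∈old : bag o v x ≡ true
      x∈old with moved-or-kept x
      ... | inj₁ (_ , o′x≡p) = ⊥-elim (v≢p (trans (sym (==-sound x∈)) o′x≡p))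
      ... | inj₂ (_ , o′x≡ox) = trans (cong (_== v) (sym o′x≡ox)) x∈
    ... | yes refl with moved-or-kept x
    ... | inj₂ (_ , o′x≡ox) = walk-mono (λ z z∈ → ==-complete (stays p p≢ℓ z (==-sound z∈)))
                                       (bag-connected p p-root x (trans (cong (_== p) (sym o′x≡ox)) x∈))
    ... | inj₁ (ox≡ℓ , _) = step (==-complete o′-p) (trans (Graph.sym G p ℓ) ℓ~p)
                                 (walk-mono (λ z z∈ → ==-complete (redirect-ℓ {o z} (==-sound z∈)))
                                            (bag-connected ℓ ℓ-root x (==-complete ox≡ℓ)))

    -- An edge between two new bags joined two old bags, neither of them ℓ:
    -- the only edge leaving bag ℓ now lies inside bag p.
    edges-at-roots′ : ∀ u w → adj G u w ≡ true → o′ u ≢ o′ w → o′ u ≡ u × o′ w ≡ w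
    edges-at-roots′ u w u~w o′u≢o′w = o′-root u u-root u≢ℓ , o′-root w w-root w≢ℓ
      where
      ou≢ow : o u ≢ o w
      ou≢ow ou≡ow = o′u≢o′w (cong redirect ou≡ow)
      u-root = proj₁ (edges-at-roots u w u~w ou≢ow)
      w-root = proj₂ (edges-at-roots u w u~w ou≢ow)
      u≢ℓ : u ≢ ℓ
      u≢ℓ refl = o′u≢o′w (trans o′-ℓ (trans (sym o′-p) (cong o′ (sym (p-unique w u~w w-root)))))
      w≢ℓ : w ≢ ℓ
      w≢ℓ refl = o′u≢o′w (trans (cong o′ (p-unique u (trans (Graph.sym G ℓ u) u~w) u-root)) (trans o′-p (sym o′-ℓ)))

    isRoot-unchanged : ∀ u → u ≢ ℓ → isRoot o′ u ≡ isRoot o u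
    isRoot-unchanged u u≢ℓ with moved-or-kept u
    ... | inj₂ (_ , o′u≡ou) = cong (_== u) o′u≡ou
    ... | inj₁ (ou≡ℓ , o′u≡p) = begin
      o′ u == u  ≡⟨ cong (_== u) o′u≡p ⟩
      p == u     ≡⟨ ==-distinct p≢u ⟩
      false      ≡⟨ ==-distinct (u≢ℓ ∘ sym) ⟨
      ℓ == u     ≡⟨ cong (_== u) ou≡ℓ ⟨
      o u == u   ∎
      where
      open ≡-Reasoning
      p≢u : p ≢ u
      p≢u p≡u = p≢ℓ (trans (sym p-root) (trans (cong o p≡u) ou≡ℓ))

    isRoot-ℓ : isRoot o ℓ ≡ true
    isRoot-ℓ = ==-complete ℓ-root

    isRoot′-ℓ : isRoot o′ ℓ ≡ false
    isRoot′-ℓ = trans (cong (_== ℓ) o′-ℓ) (==-distinct p≢ℓ)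

    rootCount-merge : rootCount o ≡ suc (rootCount o′)
    rootCount-merge = ∑-differ-at ℓ 1 (λ u u≢ℓ → cong bit (sym (isRoot-unchanged u u≢ℓ)))
      (subst₂ (λ s t → bit s ≡ 1 + bit t) (sym isRoot-ℓ) (sym isRoot′-ℓ) refl)

    rootDegree-merge : ∀ v → rootDegree o v ≡ bit (adj G v ℓ) + rootDegree o′ v
    rootDegree-merge v = ∑-differ-at ℓ (bit (adj G v ℓ))
      (λ u u≢ℓ → cong (λ t → bit (adj G v u ∧ t)) (sym (isRoot-unchanged u u≢ℓ)))
      (subst₂ (λ s t → bit (adj G v ℓ ∧ s) ≡ bit (adj G v ℓ) + bit (adj G v ℓ ∧ t))
              (sym isRoot-ℓ) (sym isRoot′-ℓ) (bit-split (adj G v ℓ)))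
      where
      bit-split : ∀ a → bit (a ∧ true) ≡ bit a + bit (a ∧ false)
      bit-split true = refl
      bit-split false = refl

    bagSize-p : bagSize o′ p ≡ bagSize o p + bagSize o ℓ
    bagSize-p = trans (sum-cong-≗ split) (∑-distrib-+ (bit ∘ bag o p) (bit ∘ bag o ℓ))
      where
      split : ∀ x → bit (o′ x == p) ≡ bit (o x == p) + bit (o x == ℓ)
      split x with moved-or-kept x
      ... | inj₁ (ox≡ℓ , o′x≡p) rewrite o′x≡p | ox≡ℓ | ==-complete {u = p} refl
                                       | ==-distinct (p≢ℓ ∘ sym) | ==-complete {u = ℓ} refl = refl
      ... | inj₂ (ox≢ℓ , o′x≡ox) rewrite o′x≡ox | ==-distinct ox≢ℓ = sym (+-identityʳ _)

    bagSize-other : ∀ v → v ≢ p → v ≢ ℓ → bagSize o′ v ≡ bagSize o v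
    bagSize-other v v≢p v≢ℓ = sum-cong-≗ same
      where
      same : ∀ x → bit (o′ x == v) ≡ bit (o x == v)
      same x with moved-or-kept x
      ... | inj₁ (ox≡ℓ , o′x≡p) rewrite o′x≡p | ox≡ℓ | ==-distinct (v≢p ∘ sym) | ==-distinct (v≢ℓ ∘ sym) = refl
      ... | inj₂ (_ , o′x≡ox) rewrite o′x≡ox = refl

    bag-bound′ : ∀ v → o′ v ≡ v → bagSize o′ v + c * rootDegree o′ v ≤ 1 + Δ * c
    bag-bound′ v o′v≡v with v ≟ p
    ... | yes refl = begin
      bagSize o′ p + c * rootDegree o′ p           ≡⟨ cong (_+ c * rootDegree o′ p) bagSize-p ⟩
      bagSize o p + bagSize o ℓ + c * rootDegree o′ p ≤⟨ +-monoˡ-≤ (c * rootDegree o′ p) (+-monoʳ-≤ (bagSize o p) light) ⟩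
      bagSize o p + c + c * rootDegree o′ p         ≡⟨ +-assoc (bagSize o p) c _ ⟩
      bagSize o p + (c + c * rootDegree o′ p)       ≡⟨ cong (bagSize o p +_) (*-suc c (rootDegree o′ p)) ⟨
      bagSize o p + c * suc (rootDegree o′ p)       ≡⟨ cong (λ d → bagSize o p + c * d) p-degree ⟨
      bagSize o p + c * rootDegree o p              ≤⟨ bag-bound p p-root ⟩
      1 + Δ * c                                    ∎
      where
      open ≤-Reasoning
      p-degree : rootDegree o p ≡ suc (rootDegree o′ p)
      p-degree = trans (rootDegree-merge p) (cong (λ a → bit a + rootDegree o′ p) (trans (Graph.sym G p ℓ) ℓ~p))
    ... | no v≢p = ≤-trans (+-mono-≤ (≤-reflexive (bagSize-other v v≢p v≢ℓ))
                                     (*-monoʳ-≤ c (subst (rootDegree o′ v ≤_) (sym (rootDegree-merge v)) (m≤n+m _ _))))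
                           (bag-bound v (proj₁ (new-root v o′v≡v)))
      where v≢ℓ = proj₂ (new-root v o′v≡v)

    -- Removing the leaf ℓ and its edge lowers the degree sum by two.
    rootDegreeSum-merge : rootDegreeSum o ≡ 2 + rootDegreeSum o′
    rootDegreeSum-merge = begin
      rootDegreeSum o                                                   ≡⟨ ∑-differ-at ℓ 1 agree at-ℓ ⟩
      1 + ∑ (λ v → bit (isRoot o′ v) * rootDegree o v)                  ≡⟨ cong (1 +_) (sum-cong-≗ (λ v →
                                                                            trans (cong (bit (isRoot o′ v) *_) (rootDegree-merge v))
                                                                                  (*-distribˡ-+ (bit (isRoot o′ v)) _ _))) ⟩
      1 + ∑ (λ v → toℓ v + bit (isRoot o′ v) * rootDegree o′ v)          ≡⟨ cong (1 +_) (∑-distrib-+ toℓ _) ⟩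
      1 + (∑ toℓ + rootDegreeSum o′)                                    ≡⟨ cong (λ s → 1 + (s + rootDegreeSum o′)) edges-to-ℓ ⟩
      2 + rootDegreeSum o′                                              ∎
      where
      open ≡-Reasoning
      agree : ∀ v → v ≢ ℓ → bit (isRoot o v) * rootDegree o v ≡ bit (isRoot o′ v) * rootDegree o v
      agree v v≢ℓ = cong (λ b → bit b * rootDegree o v) (sym (isRoot-unchanged v v≢ℓ))
      at-ℓ : bit (isRoot o ℓ) * rootDegree o ℓ ≡ 1 + bit (isRoot o′ ℓ) * rootDegree o ℓ
      at-ℓ = subst₂ (λ s t → bit s * rootDegree o ℓ ≡ 1 + bit t * rootDegree o ℓ) (sym isRoot-ℓ) (sym isRoot′-ℓ)
                    (trans (+-identityʳ _) ℓ-degree)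
      -- new roots adjacent to ℓ: exactly the root neighbours of ℓ, i.e. p
      toℓ : Fin n → ℕ
      toℓ v = bit (isRoot o′ v) * bit (adj G v ℓ)
      edges-to-ℓ : ∑ toℓ ≡ 1
      edges-to-ℓ = trans (sum-cong-≗ same) ℓ-degree
        where
        same : ∀ v → toℓ v ≡ bit (adj G ℓ v ∧ isRoot o v)
        same v with v ≟ ℓ
        ... | yes refl rewrite Graph.irrefl G ℓ = *-zeroʳ (bit (isRoot o′ ℓ))
        ... | no v≢ℓ rewrite isRoot-unchanged v v≢ℓ | Graph.sym G v ℓ with adj G ℓ v | isRoot o v
        ...   | true  | true  = refl
        ...   | true  | false = refl
        ...   | false | b     = *-zeroʳ (bit b)

    degree-sum′ : rootDegreeSum o′ + 2 ≡ 2 * rootCount o′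
    degree-sum′ = +-cancelˡ-≡ 2 _ _ (begin
      2 + (rootDegreeSum o′ + 2)  ≡⟨ +-assoc 2 (rootDegreeSum o′) 2 ⟨
      2 + rootDegreeSum o′ + 2    ≡⟨ cong (_+ 2) rootDegreeSum-merge ⟨
      rootDegreeSum o + 2         ≡⟨ degree-sum ⟩
      2 * rootCount o             ≡⟨ cong (2 *_) rootCount-merge ⟩
      2 * suc (rootCount o′)      ≡⟨ *-suc 2 (rootCount o′) ⟩
      2 + 2 * rootCount o′        ∎)
      where open ≡-Reasoning

    valid′ : Valid o′
    valid′ = record
      { idempotent     = idempotent′
      ; bag-connected  = bag-connected′
      ; edges-at-roots = edges-at-roots′
      ; bag-bound      = bag-bound′
      ; degree-sum     = degree-sum′
      }

  -- A heavy leaf bag, with at least c + 1 vertices, is a pendant subtree: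
  -- the bag bound caps its size and its only outgoing edge is ℓp.
  heavyLeaf : ∀ {o} → Valid o → (L : Leaf o) → suc c ≤ bagSize o (Leaf.ℓ L) → PendantSubtree (suc c) (1 + Δ * c)
  heavyLeaf {o} V L heavy = record
    { members   = bag o ℓ
    ; root      = ℓ
    ; root∈     = ==-complete ℓ-root
    ; connected = bag-connected ℓ ℓ-root
    ; lower     = heavy
    ; upper     = ≤-trans (m≤m+n _ _) (bag-bound ℓ ℓ-root)
    ; pendant   = singleCrossing (bag o ℓ) ℓ p (==-complete ℓ-root) p∉bag ℓ~p only-ℓp
    }
    where
    open Valid V
    open Leaf L
    p∉bag : bag o ℓ p ≡ false
    p∉bag = trans (cong (_== ℓ) p-root) (==-distinct p≢ℓ)
    -- an edge leaving bag ℓ joins two roots, so it is ℓp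
    only-ℓp : ∀ u w → bag o ℓ u ≡ true → bag o ℓ w ≡ false → adj G u w ≡ true → u ≡ ℓ × w ≡ p
    only-ℓp u w u∈ w∉ u~w = u≡ℓ , p-unique w (subst (λ t → adj G t w ≡ true) u≡ℓ u~w) w-root
      where
      roots = edges-at-roots u w u~w (separated (_== ℓ) u∈ w∉)
      w-root = proj₂ roots
      u≡ℓ = trans (sym (proj₁ roots)) (==-sound u∈)

  module Peeling (G-connected : ConnectedIn G Subset.⊤) (small-bags : 1 + Δ * c < n) where

    module _ {o : Owner} (V : Valid o) where
      open Valid V

      -- Since the root degrees sum to 2·#roots - 2, some root has degree ≤ 1.
      lowDegreeRoot : Σ (Fin n) λ v → isRoot o v ≡ true × rootDegree o v ≤ 1
      lowDegreeRoot with Fin.any? (λ v → (isRoot o v Bool.≟ true) ×-dec (rootDegree o v ≤? 1))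
      ... | yes found = found
      ... | no ¬found = ⊥-elim (m+1+n≰m (rootDegreeSum o) (begin
        rootDegreeSum o + 2                  ≡⟨ degree-sum ⟩
        2 * rootCount o                      ≡⟨ *-distribˡ-sum 2 (bit ∘ isRoot o) ⟩
        ∑ (λ v → 2 * bit (isRoot o v))       ≤⟨ ∑-mono-≤ twice ⟩
        rootDegreeSum o                      ∎))
        where
        open ≤-Reasoning
        twice : ∀ v → 2 * bit (isRoot o v) ≤ bit (isRoot o v) * rootDegree o v
        twice v with isRoot o v in v-root
        ... | false = z≤n
        ... | true = subst (2 ≤_) (sym (+-identityʳ _)) (≰⇒> (λ deg≤1 → ¬found (v , v-root , deg≤1)))

      -- A bag cannot contain all n vertices, so besides v there is another root.
      anotherRoot : ∀ v → o v ≡ v → Σ (Fin n) λ w → isRoot o w ≡ true × w ≢ v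
      anotherRoot v v-root with Fin.any? (λ w → (isRoot o w Bool.≟ true) ×-dec ¬? (w ≟ v))
      ... | yes found = found
      ... | no ¬found = ⊥-elim (<-irrefl refl (begin-strict
        n                                    ≡⟨ count-full (bag o v) in-bag ⟨
        bagSize o v                          ≤⟨ m≤m+n _ _ ⟩
        bagSize o v + c * rootDegree o v     ≤⟨ bag-bound v v-root ⟩
        1 + Δ * c                            <⟨ small-bags ⟩
        n                                    ∎))
        where
        open ≤-Reasoning
        in-bag : ∀ u → bag o v u ≡ true
        in-bag u with o u ≟ v
        ... | yes _ = refl
        ... | no ou≢v = ⊥-elim (¬found (o u , ==-complete (idempotent u) , ou≢v))

      -- Walking from the root v to another root leaves bag v along an edge;
      -- joining two bags, that edge goes from v to a root.
      rootNeighbour : ∀ v w → o v ≡ v → isRoot o w ≡ true → w ≢ v →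
                      Σ (Fin n) λ y → adj G v y ≡ true × o y ≡ y × y ≢ v
      rootNeighbour v w v-root w-root w≢v
        with leavingEdge (bag o v) (G-connected v w Subset.∈⊤ Subset.∈⊤) (==-complete v-root)
                         (trans (cong (_== v) (==-sound {u = o w} w-root)) (==-distinct w≢v))
      ... | x , y , x∈ , y∉ , x~y with edges-at-roots x y x~y (separated (_== v) x∈ y∉)
      ... | x-root , y-root =
        y , subst (λ t → adj G t y ≡ true) (trans (sym x-root) (==-sound x∈)) x~y , y-root ,
        λ y≡v → separated (_== v) {o y} (==-complete (trans y-root y≡v)) y∉ refl

      counts : ∀ v y → adj G v y ≡ true → o y ≡ y → bit (adj G v y ∧ isRoot o y) ≡ 1
      counts v y v~y y-root = cong₂ (λ s t → bit (s ∧ t)) v~y (==-complete y-root)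

      -- A leaf of the contracted tree: a root of degree ≤ 1 has a root
      -- neighbour, so its degree is 1 and that neighbour is unique.
      findLeaf : Leaf o
      findLeaf with lowDegreeRoot
      ... | ℓ , ℓ∈roots , degree≤1 with anotherRoot ℓ (==-sound ℓ∈roots)
      ... | w , w∈roots , w≢ℓ with rootNeighbour ℓ w (==-sound ℓ∈roots) w∈roots w≢ℓ
      ... | p , ℓ~p , p-root , p≢ℓ = record
        { ℓ = ℓ ; p = p ; ℓ-root = ==-sound ℓ∈roots ; p-root = p-root ; p≢ℓ = p≢ℓ ; ℓ~p = ℓ~p
        ; ℓ-degree = ≤-antisym degree≤1 (subst (_≤ rootDegree o ℓ) (counts ℓ p ℓ~p p-root) (∑-≥-term p _))
        ; p-unique = unique
        }
        where
        unique : ∀ z → adj G ℓ z ≡ true → o z ≡ z → z ≡ p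
        unique z ℓ~z z-root with z ≟ p
        ... | yes z≡p = z≡p
        ... | no z≢p = ⊥-elim (<-irrefl refl (≤-trans
          (subst (_≤ rootDegree o ℓ) (cong₂ _+_ (counts ℓ z ℓ~z z-root) (counts ℓ p ℓ~p p-root)) (∑-≥-two-terms _ z≢p))
          degree≤1))

    -- Merge light leaf bags until a heavy one appears.  Each merge removes a
    -- root, and a contraction always has a root.
    peel : ∀ k {o} → Valid o → rootCount o ≡ k → PendantSubtree (suc c) (1 + Δ * c)
    peel zero V no-roots = ⊥-elim (m+1+n≢0 _ (trans (Valid.degree-sum V) (cong (2 *_) no-roots)))
    peel (suc k) {o} V roots≡ with findLeaf V
    ... | L with suc c ≤? bagSize o (Leaf.ℓ L)
    ... | yes heavy = heavyLeaf V L heavy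
    ... | no ¬heavy = peel k (Merge.valid′ V L light) (suc-injective (trans (sym (Merge.rootCount-merge V L light)) roots≡))
      where light = ≤-pred (≰⇒> ¬heavy)

  pendantSubtree : IsTree G → (∀ v → degree G v ≤ Δ) → 1 + Δ * c < n → PendantSubtree (suc c) (1 + Δ * c)
  pendantSubtree (G-connected , edges) degree≤Δ small-bags =
    Peeling.peel G-connected small-bags (rootCount id) (trivial-valid degree≤Δ edges) refl


-- The combinatorial content of Lemma 3.1, for integers b ≥ 1 and m with
-- Δb + m < n: T₁ is the pendant subtree for c = b - 1, and T′ is T₁ grown
-- to n - m vertices.
module BalancedSubtrees where

  open import Defs hiding (sym)
  open VertexSets
  open import Data.Nat
  open import Data.Nat.Properties
  open import Data.Fin.Subset using (Subset; _⊆_; ∣_∣)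
  open import Data.Product
  open import Relation.Binary.PropositionalEquality
  import Data.Vec as V

  balancedSubtrees : ∀ {n} (T : Graph n) (Δ b m : ℕ) → IsTree T → (∀ v → degree T v ≤ Δ) → 1 ≤ Δ → 1 ≤ b →
                     Δ * b + m < n →
    Σ (Subset n) λ T₁ → Σ (Subset n) λ T′ →
      IsSubtree T T₁ × IsSubtree T T′ × T₁ ⊆ T′ ×
      (b ≤ ∣ T₁ ∣ × ∣ T₁ ∣ ≤ Δ * b) ×
      crossEdges T T₁ ≡ 1 ×
      n ∸ ∣ T′ ∣ ≡ m
  balancedSubtrees {n} T Δ (suc c) m tree degree≤Δ 1≤Δ _ Δb+m<n =
    V.tabulate members , V.tabulate extension ,
    asSubtree root∈ connected , asSubtree (⊆extension root root∈) extension-connected ,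
    (λ {x} x∈T₁ → ∈-tabulate⁺ extension x (⊆extension x (∈-tabulate⁻ members x x∈T₁))) ,
    (subst (suc c ≤_) (sym (count-tabulate members)) lower ,
     subst (_≤ Δ * suc c) (sym (count-tabulate members)) (≤-trans upper 1+Δc≤Δb)) ,
    pendant ,
    trans (cong (n ∸_) (trans (count-tabulate extension) extension-size)) (m∸[m∸n]≡n m≤n)
    where
    open Walks T
    1+Δc≤Δb : 1 + Δ * c ≤ Δ * suc c
    1+Δc≤Δb = subst (1 + Δ * c ≤_) (sym (*-suc Δ c)) (+-monoˡ-≤ (Δ * c) 1≤Δ)
    Δb≤n∸m : Δ * suc c ≤ n ∸ m
    Δb≤n∸m = m+n≤o⇒m≤o∸n (Δ * suc c) (<⇒≤ Δb+m<n)
    m≤n : m ≤ n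
    m≤n = ≤-trans (m≤n+m m (Δ * suc c)) (<⇒≤ Δb+m<n)
    open PendantSubtree (Contraction.pendantSubtree T Δ c tree degree≤Δ
                           (≤-<-trans 1+Δc≤Δb (≤-<-trans (m≤m+n (Δ * suc c) m) Δb+m<n)))
    open Extension (growTo (proj₁ tree) members root root∈ connected
                           (≤-trans upper (≤-trans 1+Δc≤Δb Δb≤n∸m)) (m∸n≤m n m))


open import Defs
open import Data.Nat using (ℕ; _*_; _∸_; _≤_; NonZero)
open import Data.Fin.Subset using (Subset; _⊆_; ∣_∣)
open import Data.Product using (Σ; _×_)
open import Relation.Binary.PropositionalEquality using (_≡_)
open import Data.Rational using (ℚ; 0ℚ; 1ℚ; _<_; _+_)
import Data.Rational

open import Data.Nat using (>-nonZero⁻¹)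
open import Data.Product using (_,_)
open RationalBounds using (integerBounds)
open BalancedSubtrees using (balancedSubtrees)

lemma3p1 : (β ε : ℚ) (n Δ : ℕ) → 0ℚ < β → 0ℚ < ε → NonZero n → NonZero Δ →
    (ℕtoℚ Δ Data.Rational.* β) + (ℕtoℚ 2 Data.Rational.* ε) < 1ℚ →
    (b m : ℕ) → β Data.Rational.* ℕtoℚ n ≡ ℕtoℚ b →
    (ℕtoℚ 2 Data.Rational.* ε) Data.Rational.* ℕtoℚ n ≡ ℕtoℚ m →
    (T : Graph n) → IsTree T → (∀ v → degree T v ≤ Δ) →
    Σ (Subset n) λ T₁ → Σ (Subset n) λ T′ →
      IsSubtree T T₁ × IsSubtree T T′ × T₁ ⊆ T′ ×
      (b ≤ ∣ T₁ ∣ × ∣ T₁ ∣ ≤ Δ * b) ×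
      crossEdges T T₁ ≡ 1 ×
      n ∸ ∣ T′ ∣ ≡ m
lemma3p1 β ε n Δ β>0 _ n≢0 Δ≢0 Δβ+2ε<1 b m βn≡b 2εn≡m T tree degree≤Δ =
  let 1≤b , Δb+m<n = integerBounds β (ℕtoℚ 2 Data.Rational.* ε) n Δ b m {{n≢0}} β>0 Δβ+2ε<1 βn≡b 2εn≡m
  in balancedSubtrees T Δ b m tree degree≤Δ (>-nonZero⁻¹ Δ {{Δ≢0}}) 1≤b Δb+m<n
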